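{- Let $G$ be a graph with maximum degree $\Delta(G)\le 3$ whose vertex set can be partitioned into the vertex sets of cycles of $G$. Then $G$ is an AR-graph.
   Context: All graphs are finite, simple and undirected; $\mathbb{N}=\{1,2,3,\dots\}$. Let $f:E(G)\to\mathbb{N}$ be an injective edge labeling of a graph $G$. A vertex $v$ is an AR-vertex (under $f$) if, whenever $x_1,\dots,x_k$ are the labels of the $k$ edges incident on $v$, the $2^k$ sums $\sum_{i\in S}x_i$ over all subsets $S\subseteq\{1,\dots,k\}$ are pairwise distinct. An injective labeling $f:E(G)\to\mathbb{N}$ is an AR-labeling if every vertex of $G$ is an AR-vertex under $f$. A graph $G$ with $m$ edges is an AR-graph if it has an AR-labeling $f:E(G)\to\{1,2,\dots,m\}$. -}

module Defs where

open import Data.Nat using (ℕ; _≤_; _<_)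
open import Data.Bool using (Bool; true; false; if_then_else_)
open import Data.Fin using (Fin)
import Data.Fin as Fin
open import Data.Fin.Properties using (_≟_)
open import Data.Fin.Subset using (Subset; _∈_; ∣_∣)
open import Data.Product using (_×_; proj₁; proj₂; Σ; ∃)
open import Data.Sum using (_⊎_)
open import Data.List using (List; length; lookup; _++_; take; concat; allFin)
open import Data.List.Membership.Propositional renaming (_∈_ to _∈ₗ_)
open import Data.List.Relation.Unary.All using (All)
open import Data.List.Relation.Unary.Unique.Propositional using (Unique)
open import Data.List.Relation.Unary.Linked using (Linked)
open import Data.List.Relation.Binary.Permutation.Propositional using (_↭_)
import Data.Vec as Vec
open import Relation.Binary.PropositionalEquality using (_≡_)
open import Relation.Nullary using (Dec; does)
open import Relation.Nullary.Decidable using () renaming (_⊎-dec_ to _⊎?_)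
open import Function.Definitions using (Injective)

-- Each edge {u,v} is stored once as an ordered pair (u , v) with u < v,
-- so there are no loops and (by Unique) no multiple edges.
record Graph : Set where
  field
    n       : ℕ
    edges   : List (Fin n × Fin n)
    ordered : All (λ e → proj₁ e Fin.< proj₂ e) edges
    simple  : Unique edges

  m : ℕ
  m = length edges

  edge : Fin m → Fin n × Fin n
  edge i = lookup edges i

  Adj : Fin n → Fin n → Set
  Adj u v = ((u Data.Product., v) ∈ₗ edges) ⊎ ((v Data.Product., u) ∈ₗ edges)

  Incident : Fin n → Fin m → Set
  Incident v i = (proj₁ (edge i) ≡ v) ⊎ (proj₂ (edge i) ≡ v)

  incident? : (v : Fin n) (i : Fin m) → Dec (Incident v i)
  incident? v i = (proj₁ (edge i) ≟ v) ⊎? (proj₂ (edge i) ≟ v)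

  incSet : Fin n → Subset m
  incSet v = Vec.tabulate (λ i → does (incident? v i))

  degree : Fin n → ℕ
  degree v = ∣ incSet v ∣

  MaxDegree≤ : ℕ → Set
  MaxDegree≤ d = ∀ v → degree v ≤ d

  IsCycle : List (Fin n) → Set
  IsCycle vs = (3 ≤ length vs) × Unique vs × Linked Adj (vs ++ take 1 vs)

  CyclePartition : Set
  CyclePartition = Σ (List (List (Fin n))) λ cs → All IsCycle cs × (concat cs ↭ allFin n)

  subsetSum : (Fin m → ℕ) → Subset m → ℕ
  subsetSum f S = Vec.sum (Vec.tabulate (λ i → if Vec.lookup S i then f i else 0))

  IsARVertex : (Fin m → ℕ) → Fin n → Set
  IsARVertex f v = ∀ (S T : Subset m) →
    (∀ i → i ∈ S → Incident v i) → (∀ i → i ∈ T → Incident v i) →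
    subsetSum f S ≡ subsetSum f T → S ≡ T

  IsARLabeling : (Fin m → ℕ) → Set
  IsARLabeling f = Injective _≡_ _≡_ f × (∀ v → IsARVertex f v)

  IsARGraph : Set
  IsARGraph = ∃ λ (f : Fin m → ℕ) → (∀ i → 1 ≤ f i × f i ≤ m) × IsARLabeling f

open Graph public

module Submission where

-- Every vertex lies on exactly one cycle of the partition, so it meets two cycle edges and, as
-- Δ ≤ 3, at most one other edge. Three distinct positive numbers, none the sum of the other two,
-- have distinct subset sums; so it suffices that at each vertex the largest label is not the sum
-- of the other two. Choose in each cycle a closing edge; the rest of the cycle is a path. Label first the
-- closing edges (1 … R), then the edges outside the cycles (R + 1 … R + k), then the path edges,
-- cycle by cycle in order along each path. At an inner vertex of a path the two cycle labels are
-- consecutive and the third label is at least 2; at an end of a path the path label exceeds the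
-- sum of the other two, except at the start of the first path when its third edge is the last
-- edge outside the cycles, which a rotation of the first cycle avoids.

open import Defs

open import Data.Bool using (true; false; if_then_else_)
open import Data.Empty using (⊥; ⊥-elim)
import Data.Fin as Fin
open import Data.Fin using (Fin; zero; suc; toℕ)
open import Data.Fin.Properties using (_≟_; any?; pigeonhole; toℕ-injective) renaming (<-asym to <-asymᶠ)
open import Data.Fin.Subset using (Subset; _∈_; _⊆_; _-_; ∣_∣) renaming (⊥ to ∅)
open import Data.Fin.Subset.Properties using (Empty-unique; ⊆-antisym; x∈p∧x≢y⇒x∈p-y; x∈p⇒∣p-x∣<∣p∣)
open import Data.List as List using (List; []; _∷_; [_]; length; _++_; concat)
open import Data.List.Membership.Propositional using () renaming (_∈_ to _∈ₗ_; _∉_ to _∉ₗ_)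
import Data.List.Membership.DecPropositional as DecMembership
open import Data.List.Membership.Propositional.Properties
  using (∈-filter⁺; ∈-filter⁻; ∈-allFin; ∈-++⁺ˡ; ∈-++⁺ʳ; ∈-++⁻; ∈-lookup)
open import Data.List.Relation.Binary.Permutation.Propositional using (_↭_; prep; ↭⇒↭ₛ; ↭-refl; ↭-sym; ↭-trans)
open import Data.List.Relation.Binary.Permutation.Propositional.Properties
  using (∷↭∷ʳ; ↭-length; shifts; ++⁺ˡ; ++⁺ʳ; ∈-resp-↭)
import Data.List.Relation.Binary.Permutation.Setoid.Properties as ↭ₛ
import Data.List.Relation.Unary.All as All
import Data.List.Relation.Unary.AllPairs as AllPairs
open import Data.List.Relation.Unary.Any as Any using (Any)
open import Data.List.Relation.Unary.Any.Properties using (lookup-index)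
open import Data.List.Relation.Unary.Linked as Linked using (Linked)
open import Data.List.Relation.Unary.Unique.Propositional using (Unique)
import Data.List.Relation.Unary.Unique.Propositional.Properties as Uniqueₚ
open import Data.Nat using (ℕ; zero; suc; _+_; _≤_; _<_; z≤n; s≤s; _≤?_)
open import Data.Nat.Properties
  using ( +-commutativeSemigroup; +-assoc; +-comm; +-identityʳ; +-suc; +-cancelˡ-≡; m+n≡0⇒m≡0; suc-injective
        ; ≤-refl; ≤-reflexive; ≤-trans; <-trans; <-≤-trans; ≤-pred; <-irrefl; <⇒≢; <⇒≱; ≰⇒>; ≤∧≢⇒<; n<1+n
        ; m≤m+n; m≤n+m; +-mono-≤; +-monoʳ-≤; +-monoˡ-≤; +-monoʳ-<; +-mono-≤-<; module ≤-Reasoning )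
  renaming (_≟_ to _≟ℕ_)
open import Algebra.Properties.CommutativeSemigroup +-commutativeSemigroup using (x∙yz≈y∙xz)
open import Data.Nat.Tactic.RingSolver using (solve-∀)
open import Data.Product using (_,_; _×_; proj₁; proj₂; ∃)
open import Data.Sum as Sum using (_⊎_; inj₁; inj₂)
open import Data.Vec using (Vec; []; _∷_; here; there; lookup; map; tabulate; _[_]≔_; sum)
open import Data.Vec.Membership.Propositional renaming (_∈_ to _∈ᵥ_)
open import Data.Vec.Properties
  using ([]=⇒lookup; lookup⇒[]=; []≔-minimal; lookup∘update; lookup∘update′; lookup∘tabulate; map-cong; ∷-injectiveˡ; ∷-injectiveʳ)
open import Data.Vec.Relation.Unary.All using (All; []; _∷_)
open import Data.Vec.Relation.Unary.Any using (here; there)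
open import Data.Vec.Relation.Unary.Unique.Propositional using ([]; _∷_) renaming (Unique to Uniqueᵛ)
open import Function using (_∘_; case_of_)
open import Function.Definitions using (Injective)
open import Relation.Binary.PropositionalEquality hiding ([_])
open import Relation.Nullary using (¬_; ¬?; yes; no; _×-dec_)
open import Relation.Nullary.Decidable using (dec-true)
open import Relation.Unary using (Decidable)

-- Subset sums
Σ⟨_⟩_ : ∀ {k} → Subset k → Vec ℕ k → ℕ
Σ⟨ [] ⟩ [] = 0
Σ⟨ true ∷ S ⟩ (x ∷ xs) = x + Σ⟨ S ⟩ xs
Σ⟨ false ∷ S ⟩ (x ∷ xs) = Σ⟨ S ⟩ xs

DistinctSubsetSums : ∀ {k} → Vec ℕ k → Set
DistinctSubsetSums xs = ∀ S T → Σ⟨ S ⟩ xs ≡ Σ⟨ T ⟩ xs → S ≡ T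

Separated : ∀ {k} → ℕ → ℕ → Vec ℕ k → Set
Separated x y zs = ∀ S T → x + Σ⟨ S ⟩ zs ≢ y + Σ⟨ T ⟩ zs

separated-[] : ∀ {x y} → x ≢ y → Separated x y []
separated-[] {x} {y} x≢y [] [] eq = x≢y (trans (sym (+-identityʳ x)) (trans eq (+-identityʳ y)))

separated-∷ : ∀ {k x y z} {zs : Vec ℕ k} →
  Separated x y zs → Separated (x + z) y zs → Separated x (y + z) zs → Separated x y (z ∷ zs)
separated-∷ {x = x} {y} {z} sep _ _ (true ∷ S) (true ∷ T) eq =
  sep S T (+-cancelˡ-≡ z _ _ (trans (sym (x∙yz≈y∙xz x z _)) (trans eq (x∙yz≈y∙xz y z _))))
separated-∷ {x = x} {z = z} _ sepˡ _ (true ∷ S) (false ∷ T) eq = sepˡ S T (trans (+-assoc x z _) eq)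
separated-∷ {y = y} {z} _ _ sepʳ (false ∷ S) (true ∷ T) eq = sepʳ S T (trans eq (sym (+-assoc y z _)))
separated-∷ sep _ _ (false ∷ S) (false ∷ T) eq = sep S T eq

separated-single : ∀ {x y z} → x ≢ y → x + z ≢ y → x ≢ y + z → Separated x y (z ∷ [])
separated-single x≢y x+z≢y x≢y+z =
  separated-∷ (separated-[] x≢y) (separated-[] x+z≢y) (separated-[] x≢y+z)

distinct-[] : DistinctSubsetSums []
distinct-[] [] [] _ = refl

distinct-∷ : ∀ {k x} {xs : Vec ℕ k} → Separated x 0 xs → DistinctSubsetSums xs → DistinctSubsetSums (x ∷ xs)
distinct-∷ {x = x} _ dist (true ∷ S) (true ∷ T) eq = cong (true ∷_) (dist S T (+-cancelˡ-≡ x _ _ eq))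
distinct-∷ sep _ (true ∷ S) (false ∷ T) eq = ⊥-elim (sep S T eq)
distinct-∷ sep _ (false ∷ S) (true ∷ T) eq = ⊥-elim (sep T S (sym eq))
distinct-∷ _ dist (false ∷ S) (false ∷ T) eq = cong (false ∷_) (dist S T eq)

distinct₂ : ∀ {a b} → a ≢ 0 → b ≢ 0 → a ≢ b → DistinctSubsetSums (a ∷ b ∷ [])
distinct₂ {a} a≢0 b≢0 a≢b =
  distinct-∷ (separated-single a≢0 (a≢0 ∘ m+n≡0⇒m≡0 a) a≢b) (distinct-∷ (separated-[] b≢0) distinct-[])

distinct₃ : ∀ {a b c} → a ≢ 0 → b ≢ 0 → c ≢ 0 → a ≢ b → a ≢ c → b ≢ c →
  a ≢ b + c → b ≢ a + c → c ≢ a + b → DistinctSubsetSums (a ∷ b ∷ c ∷ [])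
distinct₃ {a} {b} a≢0 b≢0 c≢0 a≢b a≢c b≢c a≢b+c b≢a+c c≢a+b =
  distinct-∷ (separated-∷ (separated-single a≢0 (a≢0 ∘ m+n≡0⇒m≡0 a) a≢c)
                          (separated-single a+b≢0 (a+b≢0 ∘ m+n≡0⇒m≡0 (a + b)) (≢-sym c≢a+b))
                          (separated-single a≢b (≢-sym b≢a+c) a≢b+c))
             (distinct₂ b≢0 c≢0 b≢c)
  where
  a+b≢0 : a + b ≢ 0
  a+b≢0 = a≢0 ∘ m+n≡0⇒m≡0 a

Σ⟨∅⟩≡0 : ∀ {k} (xs : Vec ℕ k) → Σ⟨ ∅ ⟩ xs ≡ 0
Σ⟨∅⟩≡0 [] = refl
Σ⟨∅⟩≡0 (_ ∷ xs) = Σ⟨∅⟩≡0 xs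

Σ⟨⟩-remove : ∀ {k} {S : Subset k} {e} (xs : Vec ℕ k) → e ∈ S →
  Σ⟨ S ⟩ xs ≡ lookup xs e + Σ⟨ S [ e ]≔ false ⟩ xs
Σ⟨⟩-remove (x ∷ xs) here = refl
Σ⟨⟩-remove {S = true ∷ S} {suc e} (x ∷ xs) (there e∈S) =
  trans (cong (x +_) (Σ⟨⟩-remove xs e∈S)) (x∙yz≈y∙xz x (lookup xs e) _)
Σ⟨⟩-remove {S = false ∷ S} (x ∷ xs) (there e∈S) = Σ⟨⟩-remove xs e∈S

map-≡-∈ : ∀ {A B : Set} {k} {g h : A → B} {es : Vec A k} {i} → map g es ≡ map h es → i ∈ᵥ es → g i ≡ h i
map-≡-∈ eq (here refl) = ∷-injectiveˡ eq
map-≡-∈ eq (there i∈es) = map-≡-∈ (∷-injectiveʳ eq) i∈es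

map-lookup-remove : ∀ {m k} (S : Subset m) {e} {es : Vec (Fin m) k} → All (e ≢_) es →
  map (lookup (S [ e ]≔ false)) es ≡ map (lookup S) es
map-lookup-remove S [] = refl
map-lookup-remove S {e} {i ∷ _} (e≢i ∷ e∉es) =
  cong₂ _∷_ ([]=⇒lookup ([]≔-minimal S i e (≢-sym e≢i) (lookup⇒[]= i S refl))) (map-lookup-remove S e∉es)

Σ⟨⟩-restrict : ∀ {m k} (xs : Vec ℕ m) {es : Vec (Fin m) k} {S} → Uniqueᵛ es → (∀ {i} → i ∈ S → i ∈ᵥ es) →
  Σ⟨ S ⟩ xs ≡ Σ⟨ map (lookup S) es ⟩ (map (lookup xs) es)
Σ⟨⟩-restrict xs {[]} {S} [] S⊆es
  rewrite Empty-unique {p = S} (λ where (_ , i∈S) → case S⊆es i∈S of λ ()) = Σ⟨∅⟩≡0 xs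
Σ⟨⟩-restrict xs {e ∷ es} {S} (e∉es ∷ u) S⊆es with lookup S e in e∈S
... | true = begin
  Σ⟨ S ⟩ xs                                              ≡⟨ Σ⟨⟩-remove xs (lookup⇒[]= e S e∈S) ⟩
  lookup xs e + Σ⟨ S [ e ]≔ false ⟩ xs                   ≡⟨ cong (lookup xs e +_) (Σ⟨⟩-restrict xs u S′⊆es) ⟩
  lookup xs e + Σ⟨ map (lookup (S [ e ]≔ false)) es ⟩ _  ≡⟨ cong (λ T → lookup xs e + Σ⟨ T ⟩ _) (map-lookup-remove S e∉es) ⟩
  lookup xs e + Σ⟨ map (lookup S) es ⟩ _                 ∎
  where
  open ≡-Reasoning
  S′⊆es : ∀ {i} → i ∈ S [ e ]≔ false → i ∈ᵥ es
  S′⊆es {i} i∈S′ with i ≟ e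
  ... | yes refl = case trans (sym (lookup∘update i S false)) ([]=⇒lookup i∈S′) of λ ()
  ... | no i≢e with S⊆es (lookup⇒[]= i S (trans (sym (lookup∘update′ i≢e S false)) ([]=⇒lookup i∈S′)))
  ...   | here i≡e = ⊥-elim (i≢e i≡e)
  ...   | there i∈es = i∈es
... | false = Σ⟨⟩-restrict xs u S⊆es′
  where
  S⊆es′ : ∀ {i} → i ∈ S → i ∈ᵥ es
  S⊆es′ i∈S with S⊆es i∈S
  ... | here refl = case trans (sym ([]=⇒lookup i∈S)) e∈S of λ ()
  ... | there i∈es = i∈es

Σ⟨⟩-injective-on : ∀ {m k} (xs : Vec ℕ m) {es : Vec (Fin m) k} {S T} →
  Uniqueᵛ es → DistinctSubsetSums (map (lookup xs) es) →
  (∀ {i} → i ∈ S → i ∈ᵥ es) → (∀ {i} → i ∈ T → i ∈ᵥ es) → Σ⟨ S ⟩ xs ≡ Σ⟨ T ⟩ xs → S ≡ T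
Σ⟨⟩-injective-on xs {es} {S} {T} u dist S⊆es T⊆es eq = ⊆-antisym (transfer S⊆es traces) (transfer T⊆es (sym traces))
  where
  traces : map (lookup S) es ≡ map (lookup T) es
  traces = dist _ _ (trans (sym (Σ⟨⟩-restrict xs u S⊆es)) (trans eq (Σ⟨⟩-restrict xs u T⊆es)))
  transfer : ∀ {P Q} → (∀ {i} → i ∈ P → i ∈ᵥ es) → map (lookup P) es ≡ map (lookup Q) es → P ⊆ Q
  transfer {P} {Q} P⊆es eq′ {i} i∈P = lookup⇒[]= i Q (trans (sym (map-≡-∈ eq′ (P⊆es i∈P))) ([]=⇒lookup i∈P))

sum-select≡Σ⟨⟩ : ∀ {m} (f : Fin m → ℕ) (S : Subset m) →
  sum (tabulate (λ i → if lookup S i then f i else 0)) ≡ Σ⟨ S ⟩ tabulate f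
sum-select≡Σ⟨⟩ f [] = refl
sum-select≡Σ⟨⟩ f (true ∷ S) = cong (f zero +_) (sum-select≡Σ⟨⟩ (f ∘ suc) S)
sum-select≡Σ⟨⟩ f (false ∷ S) = sum-select≡Σ⟨⟩ (f ∘ suc) S

Unique∧⊆⇒≤∣∣ : ∀ {m k} {S : Subset m} {xs : Vec (Fin m) k} → Uniqueᵛ xs → All (_∈ S) xs → k ≤ ∣ S ∣
Unique∧⊆⇒≤∣∣ [] [] = z≤n
Unique∧⊆⇒≤∣∣ (x∉xs ∷ u) (x∈S ∷ xs⊆S) = ≤-trans (s≤s (Unique∧⊆⇒≤∣∣ u (remove x∉xs xs⊆S))) (x∈p⇒∣p-x∣<∣p∣ x∈S)
  where
  remove : ∀ {m k x} {S : Subset m} {ys : Vec (Fin m) k} → All (x ≢_) ys → All (_∈ S) ys → All (_∈ S - x) ys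
  remove [] [] = []
  remove (x≢y ∷ x∉ys) (y∈S ∷ ys⊆S) = x∈p∧x≢y⇒x∈p-y y∈S (≢-sym x≢y) ∷ remove x∉ys ys⊆S

-- AR-vertices of degree at most three
module _ (G : Graph) where

  isARVertex-cover : ∀ {k} (f : Fin (m G) → ℕ) v (es : Vec (Fin (m G)) k) → Uniqueᵛ es →
    (∀ {i} → Incident G v i → i ∈ᵥ es) → DistinctSubsetSums (map f es) → IsARVertex G f v
  isARVertex-cover f v es u cover dist S T S⊆v T⊆v eq =
    Σ⟨⟩-injective-on (tabulate f) u (subst DistinctSubsetSums (sym (map-cong (lookup∘tabulate f) es)) dist)
      (λ i∈S → cover (S⊆v _ i∈S)) (λ i∈T → cover (T⊆v _ i∈T))
      (trans (sym (sum-select≡Σ⟨⟩ f S)) (trans eq (sum-select≡Σ⟨⟩ f T)))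

  Incident⇒∈incSet : ∀ {v i} → Incident G v i → i ∈ incSet G v
  Incident⇒∈incSet {v} {i} h = lookup⇒[]= i _ (trans (lookup∘tabulate _ i) (dec-true (incident? G v i) h))

  ¬four-incident-edges : ∀ {v a b c d} → degree G v ≤ 3 → Uniqueᵛ (a ∷ b ∷ c ∷ d ∷ []) →
    Incident G v a → Incident G v b → Incident G v c → Incident G v d → ⊥
  ¬four-incident-edges deg u va vb vc vd with ≤-trans (Unique∧⊆⇒≤∣∣ u
    (Incident⇒∈incSet va ∷ Incident⇒∈incSet vb ∷ Incident⇒∈incSet vc ∷ Incident⇒∈incSet vd ∷ [])) deg
  ... | s≤s (s≤s (s≤s ()))

  isARVertex-degree≤3 : (f : Fin (m G) → ℕ) → Injective _≡_ _≡_ f → (∀ i → f i ≢ 0) →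
    ∀ {v} → degree G v ≤ 3 → {P : Fin (m G) → Set} → Decidable P →
    ∀ {a b} → Incident G v a → Incident G v b → f a < f b → ¬ P a → ¬ P b →
    (∀ {i} → Incident G v i → i ≡ a ⊎ i ≡ b ⊎ P i) →
    (∀ {c} → P c → Incident G v c → f c < f b × f b ≢ f a + f c) →
    IsARVertex G f v
  isARVertex-degree≤3 f f-inj f≢0 {v} deg P? {a} {b} va vb fa<fb ¬Pa ¬Pb cover cond
    with any? (λ i → incident? G v i ×-dec P? i)
  ... | no ∄c = isARVertex-cover f v (a ∷ b ∷ []) ((a≢b ∷ []) ∷ [] ∷ []) cover₂
                  (distinct₂ (f≢0 a) (f≢0 b) (<⇒≢ fa<fb))
    where
    a≢b : a ≢ b
    a≢b = <⇒≢ fa<fb ∘ cong f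
    cover₂ : ∀ {i} → Incident G v i → i ∈ᵥ a ∷ b ∷ []
    cover₂ {i} vi with cover vi
    ... | inj₁ i≡a = here i≡a
    ... | inj₂ (inj₁ i≡b) = there (here i≡b)
    ... | inj₂ (inj₂ Pi) = ⊥-elim (∄c (i , vi , Pi))
  ... | yes (c , vc , Pc) = isARVertex-cover f v (a ∷ b ∷ c ∷ []) ((a≢b ∷ a≢c ∷ []) ∷ (b≢c ∷ []) ∷ [] ∷ []) cover₃
          (distinct₃ (f≢0 a) (f≢0 b) (f≢0 c) (<⇒≢ fa<fb) (a≢c ∘ f-inj) (≢-sym (<⇒≢ fc<fb))
            (<⇒≢ (<-≤-trans fa<fb (m≤m+n (f b) (f c)))) fb≢fa+fc (<⇒≢ (<-≤-trans fc<fb (m≤n+m (f b) (f a)))))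
    where
    fc<fb = proj₁ (cond Pc vc)
    fb≢fa+fc = proj₂ (cond Pc vc)
    a≢b : a ≢ b
    a≢b = <⇒≢ fa<fb ∘ cong f
    a≢c : a ≢ c
    a≢c refl = ¬Pa Pc
    b≢c : b ≢ c
    b≢c refl = ¬Pb Pc
    cover₃ : ∀ {i} → Incident G v i → i ∈ᵥ a ∷ b ∷ c ∷ []
    cover₃ {i} vi with cover vi
    ... | inj₁ i≡a = here i≡a
    ... | inj₂ (inj₁ i≡b) = there (here i≡b)
    ... | inj₂ (inj₂ Pi) with i ≟ c
    ...   | yes i≡c = there (there (here i≡c))
    ...   | no i≢c = ⊥-elim (¬four-incident-edges deg
              ((a≢b ∷ a≢c ∷ (λ { refl → ¬Pa Pi }) ∷ []) ∷ (b≢c ∷ (λ { refl → ¬Pb Pi }) ∷ []) ∷ (≢-sym i≢c ∷ []) ∷ [] ∷ [])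
              va vb vc vi)

-- Positions in lists
-- Indexed by ℕ rather than Fin (length xs), so that positions in concatenations can be added up.
data _[_]=_ {A : Set} : List A → ℕ → A → Set where
  here  : ∀ {x xs} → (x ∷ xs) [ 0 ]= x
  there : ∀ {y x xs t} → xs [ t ]= x → (y ∷ xs) [ suc t ]= x

module _ {A : Set} where

  []=-injective : ∀ {xs : List A} {t x y} → xs [ t ]= x → xs [ t ]= y → x ≡ y
  []=-injective here here = refl
  []=-injective (there p) (there q) = []=-injective p q

  []=⇒∈ : ∀ {xs : List A} {t x} → xs [ t ]= x → x ∈ₗ xs
  []=⇒∈ here = Any.here refl
  []=⇒∈ (there p) = Any.there ([]=⇒∈ p)

  ∈⇒[]= : ∀ {xs : List A} {x} → x ∈ₗ xs → ∃ λ t → xs [ t ]= x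
  ∈⇒[]= (Any.here refl) = 0 , here
  ∈⇒[]= (Any.there p) = let t , q = ∈⇒[]= p in suc t , there q

  []=⇒<length : ∀ {xs : List A} {t x} → xs [ t ]= x → t < length xs
  []=⇒<length here = s≤s z≤n
  []=⇒<length (there p) = s≤s ([]=⇒<length p)

  <length⇒[]= : ∀ (xs : List A) {t} → t < length xs → ∃ λ x → xs [ t ]= x
  <length⇒[]= (x ∷ xs) {zero} _ = x , here
  <length⇒[]= (x ∷ xs) {suc t} (s≤s t<n) = let y , p = <length⇒[]= xs t<n in y , there p

  Unique⇒[]=-index : ∀ {xs : List A} {t t′ x} → Unique xs → xs [ t ]= x → xs [ t′ ]= x → t ≡ t′
  Unique⇒[]=-index u here here = refl
  Unique⇒[]=-index (x∉xs AllPairs.∷ u) here (there q) = ⊥-elim (All.lookup x∉xs ([]=⇒∈ q) refl)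
  Unique⇒[]=-index (x∉xs AllPairs.∷ u) (there p) here = ⊥-elim (All.lookup x∉xs ([]=⇒∈ p) refl)
  Unique⇒[]=-index (_ AllPairs.∷ u) (there p) (there q) = cong suc (Unique⇒[]=-index u p q)

  []=-lookup : ∀ (xs : List A) (i : Fin (length xs)) → xs [ toℕ i ]= List.lookup xs i
  []=-lookup (x ∷ xs) zero = here
  []=-lookup (x ∷ xs) (suc i) = there ([]=-lookup xs i)

  []=-++⁺ˡ : ∀ {xs ys : List A} {t x} → xs [ t ]= x → (xs ++ ys) [ t ]= x
  []=-++⁺ˡ here = here
  []=-++⁺ˡ (there p) = there ([]=-++⁺ˡ p)

  []=-++⁺ʳ : ∀ (xs : List A) {ys t x} → ys [ t ]= x → (xs ++ ys) [ length xs + t ]= x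
  []=-++⁺ʳ [] p = p
  []=-++⁺ʳ (y ∷ xs) p = there ([]=-++⁺ʳ xs p)

  Unique-++⇒disjoint : ∀ (xs : List A) {ys x} → Unique (xs ++ ys) → x ∈ₗ xs → x ∉ₗ ys
  Unique-++⇒disjoint (_ ∷ xs) (x∉ AllPairs.∷ _) (Any.here refl) x∈ys = All.lookup x∉ (∈-++⁺ʳ xs x∈ys) refl
  Unique-++⇒disjoint (_ ∷ xs) (_ AllPairs.∷ u) (Any.there x∈xs) = Unique-++⇒disjoint xs u x∈xs

  Unique-++⁻ʳ : ∀ (xs : List A) {ys} → Unique (xs ++ ys) → Unique ys
  Unique-++⁻ʳ [] u = u
  Unique-++⁻ʳ (_ ∷ xs) (_ AllPairs.∷ u) = Unique-++⁻ʳ xs u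

  Unique-resp-↭ : ∀ {xs ys : List A} → xs ↭ ys → Unique xs → Unique ys
  Unique-resp-↭ p = ↭ₛ.Unique-resp-↭ (setoid A) (↭⇒↭ₛ p)

  offset : List (List A) → ℕ → ℕ
  offset [] _ = 0
  offset (xs ∷ xss) zero = 0
  offset (xs ∷ xss) (suc j) = length xs + offset xss j

  offset-zero : ∀ xss → offset xss 0 ≡ 0
  offset-zero [] = refl
  offset-zero (_ ∷ _) = refl

  []=-concat⁺ : ∀ {xss : List (List A)} {j xs q x} → xss [ j ]= xs → xs [ q ]= x → concat xss [ offset xss j + q ]= x
  []=-concat⁺ here p = []=-++⁺ˡ p
  []=-concat⁺ {ys ∷ xss} {suc j} {q = q} {x} (there pj) p =
    subst (concat (ys ∷ xss) [_]= x) (sym (+-assoc (length ys) (offset xss j) q)) ([]=-++⁺ʳ ys ([]=-concat⁺ pj p))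

  []=-map⁺ : ∀ {B : Set} (g : A → B) {xs : List A} {t x} → xs [ t ]= x → List.map g xs [ t ]= g x
  []=-map⁺ g here = here
  []=-map⁺ g (there p) = there ([]=-map⁺ g p)

module _ {A B : Set} where

  []=-concatMap⁺ : ∀ (g : A → List B) {xs : List A} {j x q y} → xs [ j ]= x → g x [ q ]= y →
    concat (List.map g xs) [ offset (List.map g xs) j + q ]= y
  []=-concatMap⁺ g x-at y-at = []=-concat⁺ ([]=-map⁺ g x-at) y-at

  ∈-concatMap⁺ : ∀ (g : A → List B) {xs : List A} {j x y} → xs [ j ]= x → y ∈ₗ g x →
    y ∈ₗ concat (List.map g xs)
  ∈-concatMap⁺ g x-at y∈ = []=⇒∈ ([]=-concatMap⁺ g x-at (proj₂ (∈⇒[]= y∈)))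

  ∈-concatMap⁻ : ∀ (g : A → List B) (xs : List A) {y} → y ∈ₗ concat (List.map g xs) →
    ∃ λ j → ∃ λ x → ∃ λ q → xs [ j ]= x × g x [ q ]= y
  ∈-concatMap⁻ g (x ∷ xs) y∈ with ∈-++⁻ (g x) y∈
  ... | inj₁ y∈gx = 0 , x , proj₁ (∈⇒[]= y∈gx) , here , proj₂ (∈⇒[]= y∈gx)
  ... | inj₂ y∈rest = let j , x′ , q , x′-at , y-at = ∈-concatMap⁻ g xs y∈rest in suc j , x′ , q , there x′-at , y-at

Unique⇒length≤ : ∀ {m} (xs : List (Fin m)) → Unique xs → length xs ≤ m
Unique⇒length≤ {m} xs u with length xs ≤? m
... | yes ≤m = ≤m
... | no ≰m =
  let i , j , i<j , same = pigeonhole (≰⇒> ≰m) (List.lookup xs)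
  in ⊥-elim (<⇒≢ i<j (Unique⇒[]=-index u ([]=-lookup xs i) (subst (xs [ toℕ j ]=_) (sym same) ([]=-lookup xs j))))

module Enumeration {m} (order : List (Fin m)) (order-unique : Unique order) (order-complete : ∀ i → i ∈ₗ order) where

  label : Fin m → ℕ
  label i = suc (proj₁ (∈⇒[]= (order-complete i)))

  label-[]= : ∀ {t i} → order [ t ]= i → label i ≡ suc t
  label-[]= i-at = cong suc (Unique⇒[]=-index order-unique (proj₂ (∈⇒[]= (order-complete _))) i-at)

  label-injective : Injective _≡_ _≡_ label
  label-injective {i} {j} eq = []=-injective (proj₂ (∈⇒[]= (order-complete i)))
    (subst (order [_]= j) (sym (suc-injective eq)) (proj₂ (∈⇒[]= (order-complete j))))

  label-range : ∀ i → 1 ≤ label i × label i ≤ m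
  label-range i = s≤s z≤n , ≤-trans ([]=⇒<length (proj₂ (∈⇒[]= (order-complete i)))) (Unique⇒length≤ order order-unique)

suc<+ : ∀ x {c} → 2 ≤ c → suc x < x + c
suc<+ x {c} 2≤c = subst (suc (suc x) ≤_) (+-comm c x) (+-monoˡ-≤ x 2≤c)

-- Cycle partitions and the labelling
module Cycles (G : Graph) where

  private
    V = Fin (n G)
    E = Fin (m G)

  Joins : E → V → V → Set
  Joins e x y = edge G e ≡ (x , y) ⊎ edge G e ≡ (y , x)

  Joins⇒Incidentˡ : ∀ {e x y} → Joins e x y → Incident G x e
  Joins⇒Incidentˡ (inj₁ eq) = inj₁ (cong proj₁ eq)
  Joins⇒Incidentˡ (inj₂ eq) = inj₂ (cong proj₂ eq)

  Joins⇒Incidentʳ : ∀ {e x y} → Joins e x y → Incident G y e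
  Joins⇒Incidentʳ (inj₁ eq) = inj₂ (cong proj₂ eq)
  Joins⇒Incidentʳ (inj₂ eq) = inj₁ (cong proj₁ eq)

  Joins-endpoints : ∀ {e x y v} → Joins e x y → Incident G v e → v ≡ x ⊎ v ≡ y
  Joins-endpoints (inj₁ eq) (inj₁ h) = inj₁ (trans (sym h) (cong proj₁ eq))
  Joins-endpoints (inj₁ eq) (inj₂ h) = inj₂ (trans (sym h) (cong proj₂ eq))
  Joins-endpoints (inj₂ eq) (inj₁ h) = inj₂ (trans (sym h) (cong proj₁ eq))
  Joins-endpoints (inj₂ eq) (inj₂ h) = inj₁ (trans (sym h) (cong proj₂ eq))

  Incident⇒Joins : ∀ {e x y} → x ≢ y → Incident G x e → Incident G y e → Joins e x y
  Incident⇒Joins x≢y (inj₁ h₁) (inj₁ h₂) = ⊥-elim (x≢y (trans (sym h₁) h₂))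
  Incident⇒Joins x≢y (inj₁ h₁) (inj₂ h₂) = inj₁ (cong₂ _,_ h₁ h₂)
  Incident⇒Joins x≢y (inj₂ h₁) (inj₁ h₂) = inj₂ (cong₂ _,_ h₂ h₁)
  Incident⇒Joins x≢y (inj₂ h₁) (inj₂ h₂) = ⊥-elim (x≢y (trans (sym h₁) h₂))

  edge-injective : ∀ i j → edge G i ≡ edge G j → i ≡ j
  edge-injective i j eq = toℕ-injective (Unique⇒[]=-index (simple G) ([]=-lookup (edges G) i)
                            (subst (edges G [ toℕ j ]=_) (sym eq) ([]=-lookup (edges G) j)))

  edge-ordered : ∀ i → proj₁ (edge G i) Fin.< proj₂ (edge G i)
  edge-ordered i = All.lookup (ordered G) (∈-lookup i)

  opposite-orientations : ∀ {e e′ x y} → edge G e ≡ (x , y) → edge G e′ ≡ (y , x) → ⊥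
  opposite-orientations {e} {e′} p q = <-asymᶠ
    (subst₂ Fin._<_ (cong proj₁ p) (cong proj₂ p) (edge-ordered e)) (subst₂ Fin._<_ (cong proj₁ q) (cong proj₂ q) (edge-ordered e′))

  Joins-unique : ∀ {e e′ x y} → Joins e x y → Joins e′ x y → e ≡ e′
  Joins-unique (inj₁ p) (inj₁ q) = edge-injective _ _ (trans p (sym q))
  Joins-unique (inj₂ p) (inj₂ q) = edge-injective _ _ (trans p (sym q))
  Joins-unique (inj₁ p) (inj₂ q) = ⊥-elim (opposite-orientations p q)
  Joins-unique (inj₂ p) (inj₁ q) = ⊥-elim (opposite-orientations q p)

  Adj⇒Joins : ∀ {x y} → Adj G x y → ∃ λ e → Joins e x y
  Adj⇒Joins (inj₁ p) = Any.index p , inj₁ (sym (lookup-index p))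
  Adj⇒Joins (inj₂ p) = Any.index p , inj₂ (sym (lookup-index p))

  data Path : V → V → List V → List E → Set where
    stop : ∀ {x} → Path x x (x ∷ []) []
    step : ∀ {x y z vs es e} → Joins e x y → Path y z vs es → Path x z (x ∷ vs) (e ∷ es)

  Path-head : ∀ {a z vs es} → Path a z vs es → vs [ 0 ]= a
  Path-head stop = here
  Path-head (step _ _) = here

  Path-last : ∀ {a z vs es} → Path a z vs es → vs [ length es ]= z
  Path-last stop = here
  Path-last (step _ P) = there (Path-last P)

  Path-length : ∀ {a z vs es} → Path a z vs es → length vs ≡ suc (length es)
  Path-length stop = refl
  Path-length (step _ P) = cong suc (Path-length P)

  Path-edge : ∀ {a z vs es q e} → Path a z vs es → es [ q ]= e →
    ∃ λ x → ∃ λ y → vs [ q ]= x × vs [ suc q ]= y × Joins e x y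
  Path-edge (step {x = x} {y} j P) here = x , y , here , there (Path-head P) , j
  Path-edge (step _ P) (there e-at) =
    let x , y , x-at , y-at , j = Path-edge P e-at in x , y , there x-at , there y-at , j

  Path-incident : ∀ {a z vs es q e v} → Path a z vs es → es [ q ]= e → Incident G v e →
    vs [ q ]= v ⊎ vs [ suc q ]= v
  Path-incident P e-at ve with Path-edge P e-at
  ... | x , y , x-at , y-at , j with Joins-endpoints j ve
  ...   | inj₁ refl = inj₁ x-at
  ...   | inj₂ refl = inj₂ y-at

  Path-∈ : ∀ {a z vs es e v} → Path a z vs es → e ∈ₗ es → Incident G v e → v ∈ₗ vs
  Path-∈ P e∈es ve with Path-incident P (proj₂ (∈⇒[]= e∈es)) ve
  ... | inj₁ v-at = []=⇒∈ v-at
  ... | inj₂ v-at = []=⇒∈ v-at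

  Path-edges-unique : ∀ {a z vs es} → Path a z vs es → Unique vs → Unique es
  Path-edges-unique stop _ = AllPairs.[]
  Path-edges-unique (step j P) (a∉vs AllPairs.∷ u) =
    All.tabulate (λ e∈es e≡e′ → All.lookup a∉vs (Path-∈ P e∈es (subst (Incident G _) e≡e′ (Joins⇒Incidentˡ j))) refl)
    AllPairs.∷ Path-edges-unique P u

  Path-snoc : ∀ {a z vs es e w} → Path a z vs es → Joins e z w → Path a w (vs ++ [ w ]) (es ++ [ e ])
  Path-snoc stop j = step j stop
  Path-snoc (step j′ P) j = step j′ (Path-snoc P j)

  record Cycle : Set where
    field
      first last  : V
      vertices    : List V
      pathEdges   : List E
      closingEdge : E
      path        : Path first last vertices pathEdges
      closes      : Joins closingEdge last first
      distinct    : Unique vertices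
      length≥3    : 3 ≤ length vertices

  open Cycle public

  cycleEdges : Cycle → List E
  cycleEdges r = closingEdge r ∷ pathEdges r

  pathEdges-length≥2 : ∀ r → 2 ≤ length (pathEdges r)
  pathEdges-length≥2 r = ≤-pred (subst (3 ≤_) (Path-length (path r)) (length≥3 r))

  closingEdge∉pathEdges : ∀ r → closingEdge r ∉ₗ pathEdges r
  closingEdge∉pathEdges r c∈ =
    let _ , c-at = ∈⇒[]= c∈
    in <⇒≱ (pathEdges-length≥2 r)
         (last-index (Path-incident (path r) c-at (Joins⇒Incidentˡ (closes r)))
                     (first-index (Path-incident (path r) c-at (Joins⇒Incidentʳ (closes r)))))
    where
    position : ∀ {t t′ x} → vertices r [ t ]= x → vertices r [ t′ ]= x → t ≡ t′
    position = Unique⇒[]=-index (distinct r)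
    first-index : ∀ {q} → vertices r [ q ]= first r ⊎ vertices r [ suc q ]= first r → q ≡ 0
    first-index (inj₁ at) = position at (Path-head (path r))
    first-index (inj₂ at) = case position at (Path-head (path r)) of λ ()
    last-index : ∀ {q} → vertices r [ q ]= last r ⊎ vertices r [ suc q ]= last r → q ≡ 0 → length (pathEdges r) ≤ 1
    last-index (inj₁ at) refl = ≤-trans (≤-reflexive (position (Path-last (path r)) at)) z≤n
    last-index (inj₂ at) refl = ≤-reflexive (position (Path-last (path r)) at)

  first≢last : ∀ r → first r ≢ last r
  first≢last r first≡last = <⇒≢ (≤-trans (s≤s z≤n) (pathEdges-length≥2 r))
    (Unique⇒[]=-index (distinct r) (Path-head (path r)) (subst (vertices r [ length (pathEdges r) ]=_) (sym first≡last) (Path-last (path r))))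

  cycleEdges-unique : ∀ r → Unique (cycleEdges r)
  cycleEdges-unique r =
    All.tabulate (λ e∈ c≡e → closingEdge∉pathEdges r (subst (_∈ₗ pathEdges r) (sym c≡e) e∈))
    AllPairs.∷ Path-edges-unique (path r) (distinct r)

  cycleEdge-endpoint : ∀ r {e v} → e ∈ₗ cycleEdges r → Incident G v e → v ∈ₗ vertices r
  cycleEdge-endpoint r (Any.here refl) ve with Joins-endpoints (closes r) ve
  ... | inj₁ refl = []=⇒∈ (Path-last (path r))
  ... | inj₂ refl = []=⇒∈ (Path-head (path r))
  cycleEdge-endpoint r (Any.there e∈) ve = Path-∈ (path r) e∈ ve

  rotate : (r : Cycle) → ∃ λ r′ → vertices r′ ↭ vertices r × cycleEdges r′ ↭ cycleEdges r × last r′ ≡ first r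
  rotate record { path = stop ; length≥3 = s≤s () }
  rotate record { first = a ; vertices = a ∷ vs ; pathEdges = e ∷ es ; closingEdge = c
                ; path = step {y = b} j P ; closes = jc ; distinct = u ; length≥3 = l }
    = record { first = b ; last = a ; vertices = vs ++ [ a ] ; pathEdges = es ++ [ c ] ; closingEdge = e
             ; path = Path-snoc P jc ; closes = j
             ; distinct = Unique-resp-↭ (∷↭∷ʳ a vs) u ; length≥3 = subst (3 ≤_) (↭-length (∷↭∷ʳ a vs)) l }
    , ↭-sym (∷↭∷ʳ a vs) , ↭-sym (∷↭∷ʳ c (e ∷ es)) , refl

  Linked⇒Path : ∀ x xs a → Linked (Adj G) ((x ∷ xs) ++ [ a ]) →
    ∃ λ z → ∃ λ es → ∃ λ c → Path x z (x ∷ xs) es × Joins c z a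
  Linked⇒Path x [] a (xa Linked.∷ Linked.[-]) = x , [] , proj₁ (Adj⇒Joins xa) , stop , proj₂ (Adj⇒Joins xa)
  Linked⇒Path x (y ∷ ys) a (xy Linked.∷ rest) =
    let z , es , c , P , J = Linked⇒Path y ys a rest
    in z , proj₁ (Adj⇒Joins xy) ∷ es , c , step (proj₂ (Adj⇒Joins xy)) P , J

  IsCycle⇒Cycle : ∀ vs → IsCycle G vs → ∃ λ r → vertices r ≡ vs
  IsCycle⇒Cycle (x ∷ xs) (l , u , linked) =
    let _ , _ , _ , P , J = Linked⇒Path x xs x linked
    in record { path = P ; closes = J ; distinct = u ; length≥3 = l } , refl

  IsCycles⇒Cycles : ∀ vss → All.All (IsCycle G) vss → ∃ λ rs → List.map vertices rs ≡ vss
  IsCycles⇒Cycles [] All.[] = [] , refl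
  IsCycles⇒Cycles (vs ∷ vss) (c All.∷ cs) =
    let r , r≡ = IsCycle⇒Cycle vs c ; rs , rs≡ = IsCycles⇒Cycles vss cs in r ∷ rs , cong₂ _∷_ r≡ rs≡

  allVertices : List Cycle → List V
  allVertices rs = concat (List.map vertices rs)

  allCycleEdges : List Cycle → List E
  allCycleEdges rs = concat (List.map cycleEdges rs)

  cycle-index-unique : ∀ {rs j j′ r r′ x} → Unique (allVertices rs) → rs [ j ]= r → rs [ j′ ]= r′ →
    x ∈ₗ vertices r → x ∈ₗ vertices r′ → j ≡ j′
  cycle-index-unique u here here _ _ = refl
  cycle-index-unique {r ∷ _} u here (there r′-at) x∈r x∈r′ =
    ⊥-elim (Unique-++⇒disjoint (vertices r) u x∈r (∈-concatMap⁺ vertices r′-at x∈r′))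
  cycle-index-unique {r′ ∷ _} u (there r-at) here x∈r x∈r′ =
    ⊥-elim (Unique-++⇒disjoint (vertices r′) u x∈r′ (∈-concatMap⁺ vertices r-at x∈r))
  cycle-index-unique {r ∷ _} u (there r-at) (there r′-at) x∈r x∈r′ =
    cong suc (cycle-index-unique (Unique-++⁻ʳ (vertices r) u) r-at r′-at x∈r x∈r′)

  allCycleEdges-unique : ∀ rs → Unique (allVertices rs) → Unique (allCycleEdges rs)
  allCycleEdges-unique [] _ = AllPairs.[]
  allCycleEdges-unique (r ∷ rs) u =
    Uniqueₚ.++⁺ (cycleEdges-unique r) (allCycleEdges-unique rs (Unique-++⁻ʳ (vertices r) u)) disjoint
    where
    disjoint : ∀ {e} → ¬ (e ∈ₗ cycleEdges r × e ∈ₗ allCycleEdges rs)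
    disjoint (e∈r , e∈rs) =
      let _ , r′ , _ , r′-at , e-at = ∈-concatMap⁻ cycleEdges rs e∈rs
      in Unique-++⇒disjoint (vertices r) u (cycleEdge-endpoint r e∈r (inj₁ refl))
           (∈-concatMap⁺ vertices r′-at (cycleEdge-endpoint r′ ([]=⇒∈ e-at) (inj₁ refl)))

  closings++paths↭allCycleEdges : ∀ rs →
    List.map closingEdge rs ++ concat (List.map pathEdges rs) ↭ allCycleEdges rs
  closings++paths↭allCycleEdges [] = ↭-refl
  closings++paths↭allCycleEdges (r ∷ rs) = prep (closingEdge r)
    (↭-trans (shifts (List.map closingEdge rs) (pathEdges r)) (++⁺ˡ (pathEdges r) (closings++paths↭allCycleEdges rs)))

  offset-pathEdges : ∀ {rs j r} → rs [ j ]= r → j + j ≤ offset (List.map pathEdges rs) j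
  offset-pathEdges here = z≤n
  offset-pathEdges {r ∷ rs} {suc j} (there r-at) =
    subst (_≤ length (pathEdges r) + offset (List.map pathEdges rs) j) (cong suc (sym (+-suc j j))) (+-mono-≤ (pathEdges-length≥2 r) (offset-pathEdges r-at))

  module Labelling
    (rs : List Cycle) (vertices-disjoint : Unique (allVertices rs)) (vertices-cover : ∀ v → v ∈ₗ allVertices rs)
    (others : List E) (others-unique : Unique others)
    (others-disjoint : ∀ {i} → i ∈ₗ others → i ∉ₗ allCycleEdges rs)
    (edges-cover : ∀ i → i ∈ₗ allCycleEdges rs ⊎ i ∈ₗ others)
    (first-free : ∀ {r t c} → rs [ 0 ]= r → others [ t ]= c → suc t ≡ length others → ¬ Incident G (first r) c)
    (deg : MaxDegree≤ G 3)
    where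

    closings paths order : List E
    closings = List.map closingEdge rs
    paths = concat (List.map pathEdges rs)
    order = closings ++ (others ++ paths)

    R k : ℕ
    R = length closings
    k = length others

    B : ℕ → ℕ
    B = offset (List.map pathEdges rs)

    order-unique : Unique order
    order-unique = Unique-resp-↭ (↭-sym (shifts closings others)) (Uniqueₚ.++⁺ others-unique cycle-unique disjoint)
      where
      cycle-unique : Unique (closings ++ paths)
      cycle-unique = Unique-resp-↭ (↭-sym (closings++paths↭allCycleEdges rs)) (allCycleEdges-unique rs vertices-disjoint)
      disjoint : ∀ {e} → ¬ (e ∈ₗ others × e ∈ₗ closings ++ paths)
      disjoint (e∈others , e∈cycle) = others-disjoint e∈others (∈-resp-↭ (closings++paths↭allCycleEdges rs) e∈cycle)

    order-complete : ∀ i → i ∈ₗ order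
    order-complete i with edges-cover i
    ... | inj₂ i∈others = ∈-++⁺ʳ closings (∈-++⁺ˡ i∈others)
    ... | inj₁ i∈cycle with ∈-++⁻ closings (∈-resp-↭ (↭-sym (closings++paths↭allCycleEdges rs)) i∈cycle)
    ...   | inj₁ i∈closings = ∈-++⁺ˡ i∈closings
    ...   | inj₂ i∈paths = ∈-++⁺ʳ closings (∈-++⁺ʳ others i∈paths)

    open Enumeration order order-unique order-complete public

    label-closing : ∀ {j r} → rs [ j ]= r → label (closingEdge r) ≡ suc j
    label-closing r-at = label-[]= ([]=-++⁺ˡ ([]=-map⁺ closingEdge r-at))

    label-other : ∀ {t c} → others [ t ]= c → label c ≡ suc (R + t)
    label-other c-at = label-[]= ([]=-++⁺ʳ closings ([]=-++⁺ˡ c-at))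

    label-path : ∀ {j r q e} → rs [ j ]= r → pathEdges r [ q ]= e → label e ≡ suc (R + (k + (B j + q)))
    label-path r-at e-at = label-[]= ([]=-++⁺ʳ closings ([]=-++⁺ʳ others ([]=-concatMap⁺ pathEdges r-at e-at)))

    closing<path : ∀ {j r q e} → rs [ j ]= r → pathEdges r [ q ]= e → label (closingEdge r) < label e
    closing<path r-at e-at = subst₂ _<_ (sym (label-closing r-at)) (sym (label-path r-at e-at))
      (s≤s (≤-trans ([]=⇒<length ([]=-map⁺ closingEdge r-at)) (m≤m+n R _)))

    other<path : ∀ {j r q e t c} → rs [ j ]= r → pathEdges r [ q ]= e → others [ t ]= c → label c < label e
    other<path r-at e-at c-at = subst₂ _<_ (sym (label-other c-at)) (sym (label-path r-at e-at))
      (s≤s (+-monoʳ-< R (≤-trans ([]=⇒<length c-at) (m≤m+n k _))))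

    data EdgeAt (r : Cycle) (p : ℕ) (i : E) : Set where
      closing : i ≡ closingEdge r → p ≡ 0 ⊎ p ≡ length (pathEdges r) → EdgeAt r p i
      onPath  : ∀ {q} → pathEdges r [ q ]= i → p ≡ q ⊎ p ≡ suc q → EdgeAt r p i
      other   : i ∈ₗ others → EdgeAt r p i

    incident-edge : ∀ {j r p v i} → rs [ j ]= r → vertices r [ p ]= v → Incident G v i → EdgeAt r p i
    incident-edge {r = r} {p} {v} {i} r-at v-at vi with edges-cover i
    ... | inj₂ i∈others = other i∈others
    ... | inj₁ i∈cycle with ∈-concatMap⁻ cycleEdges rs i∈cycle
    ...   | _ , r′ , _ , r′-at , i-at
      with cycle-index-unique vertices-disjoint r-at r′-at ([]=⇒∈ v-at) (cycleEdge-endpoint r′ ([]=⇒∈ i-at) vi)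
    ...   | refl with []=-injective r-at r′-at
    ...   | refl = within-cycle i-at
      where
      position : ∀ {t} → vertices r [ t ]= v → p ≡ t
      position = Unique⇒[]=-index (distinct r) v-at
      within-cycle : ∀ {q′} → cycleEdges r [ q′ ]= i → EdgeAt r p i
      within-cycle here with Joins-endpoints (closes r) vi
      ... | inj₁ refl = closing refl (inj₂ (position (Path-last (path r))))
      ... | inj₂ refl = closing refl (inj₁ (position (Path-head (path r))))
      within-cycle (there i-at′) with Path-incident (path r) i-at′ vi
      ... | inj₁ at = onPath i-at′ (inj₁ (position at))
      ... | inj₂ at = onPath i-at′ (inj₂ (position at))

    closing+other<path : ∀ {t j y} → t < k → j < y → suc j + suc (R + t) < suc (R + (k + y))
    closing+other<path {t} {j} {y} t<k j<y = s≤s (begin-strict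
      j + suc (R + t)  ≡⟨ rearrange j R t ⟩
      R + (suc t + j)  <⟨ +-monoʳ-< R (+-mono-≤-< t<k j<y) ⟩
      R + (k + y)      ∎)
      where
      open ≤-Reasoning
      rearrange : ∀ j R t → j + suc (R + t) ≡ R + (suc t + j)
      rearrange = solve-∀

    others? : Decidable (_∈ₗ others)
    others? i = DecMembership._∈?_ (_≟_ {m G}) i others

    cycleEdge∉others : ∀ {j r e} → rs [ j ]= r → e ∈ₗ cycleEdges r → e ∉ₗ others
    cycleEdge∉others r-at e∈ e∈others = others-disjoint e∈others (∈-concatMap⁺ cycleEdges r-at e∈)

    label≢0 : ∀ i → label i ≢ 0
    label≢0 i ()

    first-sum-free : ∀ {j r t c} → rs [ j ]= r → others [ t ]= c → Incident G (first r) c →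
      suc (R + (k + (B j + 0))) ≢ suc j + suc (R + t)
    -- For j = 0 the first path label is 1 + (R + k): the closing label plus the last other label.
    first-sum-free {zero} {t = t} r-at c-at vc eq = first-free r-at c-at (sym k≡1+t) vc
      where
      k≡1+t : k ≡ suc t
      k≡1+t = trans (sym (+-identityʳ k)) (+-cancelˡ-≡ R _ _ (trans (suc-injective
        (subst (λ b → suc (R + (k + (b + 0))) ≡ suc 0 + suc (R + t)) (offset-zero (List.map pathEdges rs)) eq)) (sym (+-suc R t))))
    first-sum-free {suc j} r-at c-at _ = ≢-sym (<⇒≢ (closing+other<path ([]=⇒<length c-at) j<B))
      where
      j<B : suc j < B (suc j) + 0
      j<B = ≤-trans (s≤s (m≤n+m (suc j) j)) (≤-trans (offset-pathEdges r-at) (m≤m+n _ 0))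

    last-sum-free : ∀ {j r t c p} → rs [ j ]= r → others [ t ]= c → 0 < p →
      suc (R + (k + (B j + p))) ≢ suc j + suc (R + t)
    last-sum-free {j} {p = p} r-at c-at 0<p = ≢-sym (<⇒≢ (closing+other<path ([]=⇒<length c-at) j<B))
      where
      j<B : j < B j + p
      j<B = <-≤-trans (s≤s (≤-trans (m≤m+n j j) (offset-pathEdges r-at))) (subst (_≤ B j + p) (+-comm (B j) 1) (+-monoʳ-≤ (B j) 0<p))

    inner-sum-free : ∀ {j r t p} → rs [ j ]= r →
      suc (R + (k + (B j + suc p))) ≢ suc (R + (k + (B j + p))) + suc (R + t)
    inner-sum-free {j} {t = t} {p} r-at =
      <⇒≢ (subst (_< suc (R + (k + (B j + p))) + suc (R + t)) (sym next) (suc<+ (suc (R + (k + (B j + p)))) 2≤c))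
      where
      next : suc (R + (k + (B j + suc p))) ≡ suc (suc (R + (k + (B j + p))))
      next = cong suc (trans (cong (λ z → R + (k + z)) (+-suc (B j) p)) (trans (cong (R +_) (+-suc k _)) (+-suc R _)))
      2≤c : 2 ≤ suc (R + t)
      2≤c = s≤s (≤-trans (≤-trans (s≤s z≤n) ([]=⇒<length ([]=-map⁺ closingEdge r-at))) (m≤m+n R t))

    isARVertex-with-cycle-edges : ∀ {v} → degree G v ≤ 3 → ∀ {a b} → Incident G v a → Incident G v b → label a < label b →
      a ∉ₗ others → b ∉ₗ others → (∀ {i} → Incident G v i → i ≡ a ⊎ i ≡ b ⊎ i ∈ₗ others) →
      (∀ {c} → c ∈ₗ others → Incident G v c → label c < label b × label b ≢ label a + label c) →
      IsARVertex G label v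
    isARVertex-with-cycle-edges deg-v = isARVertex-degree≤3 G label label-injective label≢0 deg-v others?

    first-isARVertex : ∀ {j r v} → rs [ j ]= r → vertices r [ 0 ]= v → IsARVertex G label v
    first-isARVertex {j} {r} {v} r-at v-at =
      isARVertex-with-cycle-edges (deg v) v-closing v-e₀ (closing<path r-at e₀-at)
        (cycleEdge∉others r-at (Any.here refl)) (cycleEdge∉others r-at (Any.there ([]=⇒∈ e₀-at))) cover cond
      where
      e₀ = proj₁ (<length⇒[]= (pathEdges r) (≤-trans (s≤s z≤n) (pathEdges-length≥2 r)))
      e₀-at = proj₂ (<length⇒[]= (pathEdges r) (≤-trans (s≤s z≤n) (pathEdges-length≥2 r)))
      v≡first : v ≡ first r
      v≡first = []=-injective v-at (Path-head (path r))
      v-closing : Incident G v (closingEdge r)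
      v-closing = subst (λ x → Incident G x (closingEdge r)) (sym v≡first) (Joins⇒Incidentʳ (closes r))
      v-e₀ : Incident G v e₀
      v-e₀ = let _ , _ , x-at , _ , j = Path-edge (path r) e₀-at
             in subst (λ x → Incident G x e₀) ([]=-injective x-at v-at) (Joins⇒Incidentˡ j)
      cover : ∀ {i} → Incident G v i → i ≡ closingEdge r ⊎ i ≡ e₀ ⊎ i ∈ₗ others
      cover vi with incident-edge r-at v-at vi
      ... | closing i≡c _ = inj₁ i≡c
      ... | onPath i-at (inj₁ refl) = inj₂ (inj₁ ([]=-injective i-at e₀-at))
      ... | other i∈others = inj₂ (inj₂ i∈others)
      cond : ∀ {c} → c ∈ₗ others → Incident G v c → label c < label e₀ × label e₀ ≢ label (closingEdge r) + label c
      cond c∈others vc = let _ , c-at = ∈⇒[]= c∈others in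
        other<path r-at e₀-at c-at ,
        subst₂ _≢_ (sym (label-path r-at e₀-at)) (sym (cong₂ _+_ (label-closing r-at) (label-other c-at)))
          (first-sum-free r-at c-at (subst (λ x → Incident G x _) v≡first vc))

    last-isARVertex : ∀ {j r p v} → rs [ j ]= r → vertices r [ suc p ]= v → suc p ≡ length (pathEdges r) →
      IsARVertex G label v
    last-isARVertex {j} {r} {p} {v} r-at v-at last-position =
      isARVertex-with-cycle-edges (deg v) v-closing v-e (closing<path r-at e-at)
        (cycleEdge∉others r-at (Any.here refl)) (cycleEdge∉others r-at (Any.there ([]=⇒∈ e-at))) cover cond
      where
      p<length : p < length (pathEdges r)
      p<length = ≤-reflexive last-position
      e = proj₁ (<length⇒[]= (pathEdges r) p<length)
      e-at = proj₂ (<length⇒[]= (pathEdges r) p<length)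
      v-closing : Incident G v (closingEdge r)
      v-closing = subst (λ x → Incident G x (closingEdge r))
        ([]=-injective (subst (vertices r [_]= last r) (sym last-position) (Path-last (path r))) v-at)
        (Joins⇒Incidentˡ (closes r))
      v-e : Incident G v e
      v-e = let _ , _ , _ , y-at , j = Path-edge (path r) e-at
            in subst (λ y → Incident G y e) ([]=-injective y-at v-at) (Joins⇒Incidentʳ j)
      cover : ∀ {i} → Incident G v i → i ≡ closingEdge r ⊎ i ≡ e ⊎ i ∈ₗ others
      cover vi with incident-edge r-at v-at vi
      ... | closing i≡c _ = inj₁ i≡c
      ... | onPath i-at (inj₁ refl) = ⊥-elim (<-irrefl last-position ([]=⇒<length i-at))
      ... | onPath i-at (inj₂ refl) = inj₂ (inj₁ ([]=-injective i-at e-at))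
      ... | other i∈others = inj₂ (inj₂ i∈others)
      cond : ∀ {c} → c ∈ₗ others → Incident G v c → label c < label e × label e ≢ label (closingEdge r) + label c
      cond c∈others _ = let _ , c-at = ∈⇒[]= c∈others in
        other<path r-at e-at c-at ,
        subst₂ _≢_ (sym (label-path r-at e-at)) (sym (cong₂ _+_ (label-closing r-at) (label-other c-at)))
          (last-sum-free r-at c-at (≤-pred (subst (2 ≤_) (sym last-position) (pathEdges-length≥2 r))))

    inner-isARVertex : ∀ {j r p v} → rs [ j ]= r → vertices r [ suc p ]= v → suc p < length (pathEdges r) →
      IsARVertex G label v
    inner-isARVertex {j} {r} {p} {v} r-at v-at inner =
      isARVertex-with-cycle-edges (deg v) v-a v-b a<b
        (cycleEdge∉others r-at (Any.there ([]=⇒∈ a-at))) (cycleEdge∉others r-at (Any.there ([]=⇒∈ b-at))) cover cond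
      where
      a = proj₁ (<length⇒[]= (pathEdges r) (<-trans (n<1+n p) inner))
      a-at = proj₂ (<length⇒[]= (pathEdges r) (<-trans (n<1+n p) inner))
      b = proj₁ (<length⇒[]= (pathEdges r) inner)
      b-at = proj₂ (<length⇒[]= (pathEdges r) inner)
      v-a : Incident G v a
      v-a = let _ , _ , _ , y-at , j = Path-edge (path r) a-at
            in subst (λ y → Incident G y a) ([]=-injective y-at v-at) (Joins⇒Incidentʳ j)
      v-b : Incident G v b
      v-b = let _ , _ , x-at , _ , j = Path-edge (path r) b-at
            in subst (λ x → Incident G x b) ([]=-injective x-at v-at) (Joins⇒Incidentˡ j)
      a<b : label a < label b
      a<b = subst₂ _<_ (sym (label-path r-at a-at)) (sym (label-path r-at b-at))
        (s≤s (+-monoʳ-< R (+-monoʳ-< k (+-monoʳ-< (B j) (n<1+n p)))))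
      cover : ∀ {i} → Incident G v i → i ≡ a ⊎ i ≡ b ⊎ i ∈ₗ others
      cover vi with incident-edge r-at v-at vi
      ... | closing _ (inj₂ at-last) = ⊥-elim (<-irrefl at-last inner)
      ... | onPath i-at (inj₁ refl) = inj₂ (inj₁ ([]=-injective i-at b-at))
      ... | onPath i-at (inj₂ refl) = inj₁ ([]=-injective i-at a-at)
      ... | other i∈others = inj₂ (inj₂ i∈others)
      cond : ∀ {c} → c ∈ₗ others → Incident G v c → label c < label b × label b ≢ label a + label c
      cond c∈others _ = let _ , c-at = ∈⇒[]= c∈others in
        other<path r-at b-at c-at ,
        subst₂ _≢_ (sym (label-path r-at b-at)) (sym (cong₂ _+_ (label-path r-at a-at) (label-other c-at)))
          (inner-sum-free r-at)

    isARVertex : ∀ v → IsARVertex G label v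
    isARVertex v with ∈-concatMap⁻ vertices rs (vertices-cover v)
    ... | _ , _ , zero , r-at , v-at = first-isARVertex r-at v-at
    ... | _ , r , suc p , r-at , v-at with suc p ≟ℕ length (pathEdges r)
    ...   | yes last-position = last-isARVertex r-at v-at last-position
    ...   | no ¬last = inner-isARVertex r-at v-at (≤∧≢⇒< (≤-pred (subst (suc p <_) (Path-length (path r)) ([]=⇒<length v-at))) ¬last)

    isARGraph : IsARGraph G
    isARGraph = label , label-range , label-injective , isARVertex

  module _ (deg : MaxDegree≤ G 3) where

    -- If the last other edge c meets the first vertex of the first cycle, rotate that cycle one step:
    -- c cannot also meet the next vertex, as it would then be the cycle edge between the two.
    isARGraph-choosing-start : ∀ rs → Unique (allVertices rs) → (∀ v → v ∈ₗ allVertices rs) →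
      ∀ others → Unique others → (∀ {i} → i ∈ₗ others → i ∉ₗ allCycleEdges rs) →
      (∀ i → i ∈ₗ allCycleEdges rs ⊎ i ∈ₗ others) → IsARGraph G
    isARGraph-choosing-start [] disj cover others u od ec = Labelling.isARGraph [] disj cover others u od ec (λ ()) deg
    isARGraph-choosing-start rs@(_ ∷ _) disj cover [] u od ec = Labelling.isARGraph rs disj cover [] u od ec (λ _ ()) deg
    isARGraph-choosing-start (r ∷ rest) disj cover others@(x ∷ xs) u od ec
      with <length⇒[]= others {length xs} ≤-refl
    ... | c , c-at with incident? G (first r) c
    ...   | no ¬vc = Labelling.isARGraph (r ∷ rest) disj cover others u od ec free deg
      where
      free : ∀ {r′ t c′} → (r ∷ rest) [ 0 ]= r′ → others [ t ]= c′ → suc t ≡ length others → ¬ Incident G (first r′) c′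
      free here c′-at refl = ¬vc ∘ subst (Incident G (first r)) ([]=-injective c′-at c-at)
    ...   | yes vc with rotate r
    ...     | r′ , vertices↭ , edges↭ , last≡first =
      Labelling.isARGraph (r′ ∷ rest) (Unique-resp-↭ (↭-sym V↭) disj) (λ v → ∈-resp-↭ (↭-sym V↭) (cover v))
        others u (λ i∈ i∈′ → od i∈ (∈-resp-↭ E↭ i∈′)) (λ i → Sum.map₁ (∈-resp-↭ (↭-sym E↭)) (ec i)) free deg
      where
      V↭ : allVertices (r′ ∷ rest) ↭ allVertices (r ∷ rest)
      V↭ = ++⁺ʳ (allVertices rest) vertices↭
      E↭ : allCycleEdges (r′ ∷ rest) ↭ allCycleEdges (r ∷ rest)
      E↭ = ++⁺ʳ (allCycleEdges rest) edges↭
      free : ∀ {r″ t c′} → (r′ ∷ rest) [ 0 ]= r″ → others [ t ]= c′ → suc t ≡ length others → ¬ Incident G (first r″) c′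
      free here c′-at refl v′c′ with []=-injective c′-at c-at
      ... | refl = od ([]=⇒∈ c-at) (∈-resp-↭ E↭ (Any.here c≡closing))
        where
        c≡closing : c ≡ closingEdge r′
        c≡closing = Joins-unique (Incident⇒Joins (first≢last r′ ∘ sym)
                      (subst (λ x → Incident G x c) (sym last≡first) vc) v′c′) (closes r′)

    isARGraph-from-cycles : ∀ rs → Unique (allVertices rs) → (∀ v → v ∈ₗ allVertices rs) → IsARGraph G
    isARGraph-from-cycles rs disj cover =
      isARGraph-choosing-start rs disj cover others (Uniqueₚ.filter⁺ non-cycle? (Uniqueₚ.allFin⁺ _))
        (λ i∈ → proj₂ (∈-filter⁻ non-cycle? {xs = List.allFin (m G)} i∈)) edges-cover
      where
      non-cycle? : Decidable (_∉ₗ allCycleEdges rs)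
      non-cycle? i = ¬? (DecMembership._∈?_ (_≟_ {m G}) i (allCycleEdges rs))
      others : List E
      others = List.filter non-cycle? (List.allFin (m G))
      edges-cover : ∀ i → i ∈ₗ allCycleEdges rs ⊎ i ∈ₗ others
      edges-cover i with DecMembership._∈?_ (_≟_ {m G}) i (allCycleEdges rs)
      ... | yes i∈ = inj₁ i∈
      ... | no i∉ = inj₂ (∈-filter⁺ non-cycle? (∈-allFin i) i∉)

mainTheorem3 : (G : Graph) → MaxDegree≤ G 3 → CyclePartition G → IsARGraph G
mainTheorem3 G deg (vss , are-cycles , partition) with Cycles.IsCycles⇒Cycles G vss are-cycles
... | rs , refl = Cycles.isARGraph-from-cycles G deg rs
  (Unique-resp-↭ (↭-sym partition) (Uniqueₚ.allFin⁺ _)) (λ v → ∈-resp-↭ (↭-sym partition) (∈-allFin v))
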